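{- Let $m>1$ be an integer. (i) Let $\frac{h}{k}\in\mathcal{F}(\mathbb{B}(2m),m)$ with $\frac01<\frac hk\le\frac12$. Let $x_0$ be the integer with $hx_0\equiv 1\pmod{k-h}$ and $m-k+h+1\le x_0\le m$. Then the fraction $\frac{(hx_0-1)/(k-h)}{(kx_0-1)/(k-h)}$ is the immediate predecessor of $\frac hk$ in $\mathcal{F}(\mathbb{B}(2m),m)$. (ii) Let $\frac{h}{k}\in\mathcal{F}(\mathbb{B}(2m),m)$ with $\frac01\le\frac hk<\frac12$. Let $x_0$ be the integer with $hx_0\equiv -1\pmod{k-h}$ and $m-k+h+1\le x_0\le m$. Then the fraction $\frac{(hx_0+1)/(k-h)}{(kx_0+1)/(k-h)}$ is the immediate successor of $\frac hk$ in $\mathcal{F}(\mathbb{B}(2m),m)$.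
   Context: For a positive integer $n$, $\mathcal{F}_n$ is the Farey sequence of order $n$: the ascending sequence of irreducible fractions $\frac hk$ with integers $0\le h\le k\le n$, $k\ge1$. For a positive integer $m$, $\mathcal{F}(\mathbb{B}(2m),m)$ is the ascending sequence $\left(\frac{h}{k}\in\mathcal{F}_{2m}:\ h\le m,\ k-h\le m\right)$. Fractions $\frac hk$ are written in lowest terms. -}

module Defs where

open import Data.Nat using (ℕ; _+_; _*_; _∸_; _≤_; _<_)
open import Data.Nat.Coprimality using (Coprime)
open import Data.Product using (_×_; Σ)
open import Relation.Nullary using (¬_)

Frac : Set
Frac = ℕ × ℕ

open import Data.Product using (_,_) public

-- Order of fractions (positive denominators): a/b < c/d iff a*d < c*b.
_<F_ : Frac → Frac → Set
(a , b) <F (c , d) = a * d < c * b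

_≤F_ : Frac → Frac → Set
(a , b) ≤F (c , d) = a * d ≤ c * b

InFarey : ℕ → Frac → Set
InFarey n (h , k) = Coprime h k × h ≤ k × k ≤ n × 1 ≤ k

InFB : ℕ → Frac → Set
InFB m (h , k) = InFarey (2 * m) (h , k) × h ≤ m × k ∸ h ≤ m

IsPredecessor : ℕ → Frac → Frac → Set
IsPredecessor m p q =
  InFB m p × p <F q × (∀ r → InFB m r → p <F r → ¬ (r <F q))

IsSuccessor : ℕ → Frac → Frac → Set
IsSuccessor m s q =
  InFB m s × q <F s × (∀ r → InFB m r → q <F r → ¬ (r <F s))

-- If h/k and a/b are Farey neighbours (h b − a k = 1), every fraction p/q strictly between
-- them is p/q = (L a + M h)/(L b + M k) with L = h q − p k ≥ 1 and M = p b − a q ≥ 1, so its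
-- width q − p is at least (b − a) + (k − h).  The congruence on x₀ makes the candidate a/b with
-- b − a = x₀ a neighbour of h/k, and x₀ + (k − h) > m while every member of F(B(2m), m) has
-- width at most m; the bound h/k ≤ 1/2 is what keeps a ≤ x₀ ≤ m.
module Submission where

open import Defs
open import Data.Nat using (ℕ; suc; _+_; _*_; _∸_; _≤_; _<_; z≤n; z<s; >-nonZero)
open import Data.Nat.Properties
open import Data.Nat.Divisibility using (∣1⇒≡1; ∣m+n∣m⇒∣n; ∣-trans; m∣m*n)
  renaming (_∣_ to _∣ℕ_)
open import Data.Nat.Coprimality using (Coprime)
import Data.Nat.Coprimality as Coprime
open import Data.Nat.Tactic.RingSolver using (solve)
open import Data.Integer using (+_; _-_; 1ℤ)
open import Data.Integer.Divisibility using (_∣_; divides)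
open import Data.List using (_∷_; [])
open import Data.Product using (_×_; Σ; ∃; proj₁; proj₂)
open import Relation.Nullary using (¬_)
open import Relation.Binary.PropositionalEquality
  using (_≡_; refl; sym; trans; cong; cong₂; subst; subst₂; module ≡-Reasoning)

neighbour-coordinates : ∀ {a b h k p q L M} → h * b ≡ a * k + 1 →
  p * k + L ≡ h * q → a * q + M ≡ p * b → p ≡ a * L + h * M × q ≡ b * L + k * M
neighbour-coordinates {a} {b} {h} {k} {p} {q} {L} {M} det right left =
  sym (+-cancelʳ-≡ (a * p * k + a * h * q) _ _ p-cross) ,
  sym (+-cancelʳ-≡ (b * p * k + k * a * q) _ _ q-cross)
  where
  open ≡-Reasoning
  p-cross : (a * L + h * M) + (a * p * k + a * h * q) ≡ p + (a * p * k + a * h * q)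
  p-cross = begin
    (a * L + h * M) + (a * p * k + a * h * q) ≡⟨ solve (a ∷ h ∷ k ∷ p ∷ q ∷ L ∷ M ∷ []) ⟩
    a * (p * k + L) + h * (a * q + M)         ≡⟨ cong₂ (λ u v → a * u + h * v) right left ⟩
    a * (h * q) + h * (p * b)                 ≡⟨ solve (a ∷ b ∷ h ∷ p ∷ q ∷ []) ⟩
    p * (h * b) + a * h * q                   ≡⟨ cong (λ t → p * t + a * h * q) det ⟩
    p * (a * k + 1) + a * h * q               ≡⟨ solve (a ∷ h ∷ k ∷ p ∷ q ∷ []) ⟩
    p + (a * p * k + a * h * q)               ∎
  q-cross : (b * L + k * M) + (b * p * k + k * a * q) ≡ q + (b * p * k + k * a * q)
  q-cross = begin
    (b * L + k * M) + (b * p * k + k * a * q) ≡⟨ solve (a ∷ b ∷ k ∷ p ∷ q ∷ L ∷ M ∷ []) ⟩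
    b * (p * k + L) + k * (a * q + M)         ≡⟨ cong₂ (λ u v → b * u + k * v) right left ⟩
    b * (h * q) + k * (p * b)                 ≡⟨ solve (b ∷ h ∷ k ∷ p ∷ q ∷ []) ⟩
    q * (h * b) + b * p * k                   ≡⟨ cong (λ t → q * t + b * p * k) det ⟩
    q * (a * k + 1) + b * p * k               ≡⟨ solve (a ∷ b ∷ k ∷ p ∷ q ∷ []) ⟩
    q + (b * p * k + k * a * q)               ∎

width-between-neighbours : ∀ {a x h d p q} → h * (a + x) ≡ a * (h + d) + 1 →
  (a , a + x) <F (p , q) → (p , q) <F (h , h + d) → x + d ≤ q ∸ p
width-between-neighbours {a} {x} {h} {d} {p} {q} det left right
  with h * q ∸ p * (h + d) | m+[n∸m]≡n (<⇒≤ right) | m<n⇒0<n∸m right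
     | p * (a + x) ∸ a * q | m+[n∸m]≡n (<⇒≤ left)  | m<n⇒0<n∸m left
... | L | right-gap | 0<L | M | left-gap | 0<M = begin
  x + d                   ≤⟨ +-mono-≤ (m≤m*n x L {{>-nonZero 0<L}}) (m≤m*n d M {{>-nonZero 0<M}}) ⟩
  x * L + d * M           ≡⟨ m+n∸m≡n p _ ⟨
  p + (x * L + d * M) ∸ p ≡⟨ cong (_∸ p) q-split ⟨
  q ∸ p                   ∎
  where
  open ≤-Reasoning
  coordinates : p ≡ a * L + h * M × q ≡ (a + x) * L + (h + d) * M
  coordinates = neighbour-coordinates {a} {a + x} {h} {h + d} {p} {q} {L} {M} det right-gap left-gap
  q-split : q ≡ p + (x * L + d * M)
  q-split = begin-equality
    q                                 ≡⟨ proj₂ coordinates ⟩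
    (a + x) * L + (h + d) * M         ≡⟨ solve (a ∷ x ∷ h ∷ d ∷ L ∷ M ∷ []) ⟩
    (a * L + h * M) + (x * L + d * M) ≡⟨ cong (_+ (x * L + d * M)) (proj₁ coordinates) ⟨
    p + (x * L + d * M)               ∎

no-InFB-between-wide-neighbours : ∀ {m} a x h d → h * (a + x) ≡ a * (h + d) + 1 → m < x + d →
  ∀ r → InFB m r → (a , a + x) <F r → ¬ (r <F (h , h + d))
no-InFB-between-wide-neighbours a x h d det wide (p , q) (_ , _ , width≤m) left right =
  <⇒≱ wide (≤-trans (width-between-neighbours {a} {x} {h} {d} {p} {q} det left right) width≤m)

unit-combination⇒coprime : ∀ {i j s t} → i * s ≡ j * t + 1 → Coprime i j
unit-combination⇒coprime {i} {j} {s} {t} eq {c} (c∣i , c∣j) =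
  ∣1⇒≡1 (∣m+n∣m⇒∣n (subst (c ∣ℕ_) eq (∣-trans c∣i (m∣m*n s))) (∣-trans c∣j (m∣m*n t)))

InFB-of-width : ∀ {m a x} → Coprime a (a + x) → 1 ≤ x → a ≤ m → x ≤ m → InFB m (a , a + x)
InFB-of-width {m} {a} {x} coprime 1≤x a≤m x≤m =
  (coprime , m≤m+n a x , +-mono-≤ a≤m (≤-trans x≤m (m≤m+n m 0)) , ≤-trans 1≤x (m≤n+m x a)) ,
  a≤m , ≤-trans (≤-reflexive (m+n∸m≡n a x)) x≤m

predecessor-candidate : ∀ a d h x → a * d + 1 ≡ h * x →
  (a + x) * d + 1 ≡ (h + d) * x × h * (a + x) ≡ a * (h + d) + 1
predecessor-candidate a d h x congruence = denominator , determinant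
  where
  open ≡-Reasoning
  denominator : (a + x) * d + 1 ≡ (h + d) * x
  denominator = begin
    (a + x) * d + 1     ≡⟨ solve (a ∷ d ∷ x ∷ []) ⟩
    (a * d + 1) + x * d ≡⟨ cong (_+ x * d) congruence ⟩
    h * x + x * d       ≡⟨ solve (d ∷ h ∷ x ∷ []) ⟩
    (h + d) * x         ∎
  determinant : h * (a + x) ≡ a * (h + d) + 1
  determinant = begin
    h * (a + x)         ≡⟨ solve (a ∷ h ∷ x ∷ []) ⟩
    h * a + h * x       ≡⟨ cong (_+_ (h * a)) congruence ⟨
    h * a + (a * d + 1) ≡⟨ solve (a ∷ d ∷ h ∷ []) ⟩
    a * (h + d) + 1     ∎

successor-candidate : ∀ a d h x → a * d ≡ h * x + 1 →
  (a + x) * d ≡ (h + d) * x + 1 × a * (h + d) ≡ h * (a + x) + 1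
successor-candidate a d h x congruence = denominator , determinant
  where
  open ≡-Reasoning
  denominator : (a + x) * d ≡ (h + d) * x + 1
  denominator = begin
    (a + x) * d         ≡⟨ solve (a ∷ d ∷ x ∷ []) ⟩
    a * d + x * d       ≡⟨ cong (_+ x * d) congruence ⟩
    (h * x + 1) + x * d ≡⟨ solve (d ∷ h ∷ x ∷ []) ⟩
    (h + d) * x + 1     ∎
  determinant : a * (h + d) ≡ h * (a + x) + 1
  determinant = begin
    a * (h + d)         ≡⟨ solve (a ∷ d ∷ h ∷ []) ⟩
    a * h + a * d       ≡⟨ cong (_+_ (a * h)) congruence ⟩
    a * h + (h * x + 1) ≡⟨ solve (a ∷ h ∷ x ∷ []) ⟩
    h * (a + x) + 1     ∎

∣n-1⇒quotient : ∀ {d n} → 1 ≤ n → (+ d) ∣ (+ n - 1ℤ) → ∃ λ a → a * d + 1 ≡ n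
∣n-1⇒quotient {n = suc n} _ (divides a n≡a*d) = a , trans (+-comm _ 1) (cong suc (sym n≡a*d))

∣n+1⇒quotient : ∀ {d n} → (+ d) ∣ (+ n Data.Integer.+ 1ℤ) → ∃ λ a → a * d ≡ n + 1
∣n+1⇒quotient (divides a n+1≡a*d) = a , sym n+1≡a*d

predecessor : (m h k : ℕ) → InFB m (h , k) → (0 , 1) <F (h , k) → (h , k) ≤F (1 , 2) →
  (x₀ : ℕ) → (+ (k ∸ h)) ∣ (+ (h * x₀) - 1ℤ) → m + 1 ≤ k ∸ h + x₀ → x₀ ≤ m →
  Σ ℕ (λ a → Σ ℕ (λ b →
    (a * (k ∸ h) + 1 ≡ h * x₀) × (b * (k ∸ h) + 1 ≡ k * x₀) × IsPredecessor m (a , b) (h , k)))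
predecessor m h k ((_ , h≤k , _) , _ , d≤m) 0<h h/k≤1/2 x₀ d∣hx₀-1 m<d+x₀ x₀≤m
  with k ∸ h | m+[n∸m]≡n h≤k
... | d | refl =
  a , a + x₀ , congruence , denominator ,
  ( InFB-of-width coprime 1≤x₀ (≤-trans (<⇒≤ a<x₀) x₀≤m) x₀≤m
  , subst (a * (h + d) <_) (sym determinant) (m<m+n _ z<s)
  , no-InFB-between-wide-neighbours a x₀ h d determinant (subst₂ _≤_ (+-comm m 1) (+-comm d x₀) m<d+x₀))
  where
  1≤x₀ : 1 ≤ x₀
  1≤x₀ = +-cancelˡ-≤ m 1 x₀ (≤-trans m<d+x₀ (+-monoˡ-≤ x₀ d≤m))
  quotient : ∃ λ a → a * d + 1 ≡ h * x₀
  quotient = ∣n-1⇒quotient (*-mono-≤ (subst (1 ≤_) (*-identityʳ h) 0<h) 1≤x₀) d∣hx₀-1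
  a : ℕ
  a = proj₁ quotient
  congruence : a * d + 1 ≡ h * x₀
  congruence = proj₂ quotient
  denominator : (a + x₀) * d + 1 ≡ (h + d) * x₀
  denominator = proj₁ (predecessor-candidate a d h x₀ congruence)
  determinant : h * (a + x₀) ≡ a * (h + d) + 1
  determinant = proj₂ (predecessor-candidate a d h x₀ congruence)
  coprime : Coprime a (a + x₀)
  coprime = Coprime.sym (unit-combination⇒coprime (trans (*-comm (a + x₀) h) determinant))
  h≤d : h ≤ d
  h≤d = +-cancelˡ-≤ h h d (subst₂ _≤_ (solve (h ∷ [])) (*-identityˡ (h + d)) h/k≤1/2)
  a<x₀ : a < x₀
  a<x₀ = *-cancelʳ-< d a x₀ (begin-strict
    a * d     <⟨ m<m+n (a * d) z<s ⟩
    a * d + 1 ≡⟨ congruence ⟩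
    h * x₀    ≤⟨ *-monoˡ-≤ x₀ h≤d ⟩
    d * x₀    ≡⟨ *-comm d x₀ ⟩
    x₀ * d    ∎)
    where open ≤-Reasoning

successor : (m h k : ℕ) → InFB m (h , k) → (h , k) <F (1 , 2) →
  (x₀ : ℕ) → (+ (k ∸ h)) ∣ (+ (h * x₀) Data.Integer.+ 1ℤ) → m + 1 ≤ k ∸ h + x₀ → x₀ ≤ m →
  Σ ℕ (λ a → Σ ℕ (λ b →
    (a * (k ∸ h) ≡ h * x₀ + 1) × (b * (k ∸ h) ≡ k * x₀ + 1) × IsSuccessor m (a , b) (h , k)))
successor m h k ((_ , h≤k , _) , _ , d≤m) h/k<1/2 x₀ d∣hx₀+1 m<d+x₀ x₀≤m
  with k ∸ h | m+[n∸m]≡n h≤k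
... | d | refl =
  a , a + x₀ , congruence , denominator ,
  ( InFB-of-width coprime 1≤x₀ (≤-trans a≤x₀ x₀≤m) x₀≤m
  , subst (h * (a + x₀) <_) (sym determinant) (m<m+n _ z<s)
  , no-InFB-between-wide-neighbours h d a x₀ determinant (subst (_≤ d + x₀) (+-comm m 1) m<d+x₀))
  where
  1≤x₀ : 1 ≤ x₀
  1≤x₀ = +-cancelˡ-≤ m 1 x₀ (≤-trans m<d+x₀ (+-monoˡ-≤ x₀ d≤m))
  quotient : ∃ λ a → a * d ≡ h * x₀ + 1
  quotient = ∣n+1⇒quotient d∣hx₀+1
  a : ℕ
  a = proj₁ quotient
  congruence : a * d ≡ h * x₀ + 1
  congruence = proj₂ quotient
  denominator : (a + x₀) * d ≡ (h + d) * x₀ + 1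
  denominator = proj₁ (successor-candidate a d h x₀ congruence)
  determinant : a * (h + d) ≡ h * (a + x₀) + 1
  determinant = proj₂ (successor-candidate a d h x₀ congruence)
  coprime : Coprime a (a + x₀)
  coprime = unit-combination⇒coprime (trans determinant (cong (_+ 1) (*-comm h (a + x₀))))
  h<d : h < d
  h<d = +-cancelˡ-< h h d (subst₂ _≤_ (cong suc (solve (h ∷ []))) (*-identityˡ (h + d)) h/k<1/2)
  a≤x₀ : a ≤ x₀
  a≤x₀ = *-cancelʳ-≤ a x₀ d {{>-nonZero (≤-<-trans z≤n h<d)}} (begin
    a * d       ≡⟨ congruence ⟩
    h * x₀ + 1  ≤⟨ +-monoʳ-≤ (h * x₀) 1≤x₀ ⟩
    h * x₀ + x₀ ≡⟨ +-comm (h * x₀) x₀ ⟩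
    suc h * x₀  ≤⟨ *-monoˡ-≤ x₀ h<d ⟩
    d * x₀      ≡⟨ *-comm d x₀ ⟩
    x₀ * d      ∎)
    where open ≤-Reasoning

mainTheorem5 : (m : ℕ) → 1 < m →
    ((h k : ℕ) → InFB m (h , k) → (0 , 1) <F (h , k) → (h , k) ≤F (1 , 2) →
      (x₀ : ℕ) → (+ (k ∸ h)) ∣ (+ (h * x₀) - 1ℤ) →
      m + 1 ≤ k ∸ h + x₀ → x₀ ≤ m →
      Σ ℕ (λ a → Σ ℕ (λ b →
        (a * (k ∸ h) + 1 ≡ h * x₀) × (b * (k ∸ h) + 1 ≡ k * x₀) ×
        IsPredecessor m (a , b) (h , k))))
    ×
    ((h k : ℕ) → InFB m (h , k) → (0 , 1) ≤F (h , k) → (h , k) <F (1 , 2) →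
      (x₀ : ℕ) → (+ (k ∸ h)) ∣ (+ (h * x₀) Data.Integer.+ 1ℤ) →
      m + 1 ≤ k ∸ h + x₀ → x₀ ≤ m →
      Σ ℕ (λ a → Σ ℕ (λ b →
        (a * (k ∸ h) ≡ h * x₀ + 1) × (b * (k ∸ h) ≡ k * x₀ + 1) ×
        IsSuccessor m (a , b) (h , k))))
mainTheorem5 m _ = predecessor m , λ h k h/k∈FB _ → successor m h k h/k∈FB
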